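{- Let $1 \le s < t$ be integers and let $G$ be a $K_{s,t}$-saturated $n$ by $n$ bipartite graph with minimum degree $\delta < t-1$. Then $G$ has at least $(s+t-2)n - (t-1)(t-2)$ edges.
   Context: An $n$ by $n$ bipartite graph $G$ has fixed vertex classes $U$, $U'$ with $|U|=|U'|=n$. $G$ is $K_{s,t}$-saturated if $G$ contains no subgraph isomorphic to $K_{s,t}$ (in either orientation, i.e. with the $s$-side in $U$ or in $U'$), but adding any missing edge between $U$ and $U'$ creates a copy of $K_{s,t}$. -}

module Defs where

open import Data.Nat using (ℕ; _≤_; _<_)
open import Data.Bool using (Bool; true; false)
open import Data.Fin using (Fin)
open import Data.Fin.Subset using (Subset; ∣_∣)
open import Data.Vec using (Vec; tabulate)
open import Data.List using (List; map; allFin)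
open import Data.Nat.ListAction using (sum)
open import Data.Product using (Σ; _×_; ∃; _,_)
open import Data.Sum using (_⊎_)
open import Function.Definitions using (Injective)
open import Relation.Binary.PropositionalEquality using (_≡_)
open import Relation.Nullary using (¬_)

-- An n by n bipartite graph with vertex classes U = Fin n and U' = Fin n:
-- E u u' ≡ true iff uu' is an edge (u ∈ U, u' ∈ U').
BipGraph : ℕ → Set
BipGraph n = Fin n → Fin n → Bool

degU : ∀ {n} → BipGraph n → Fin n → ℕ
degU {n} G u = ∣ tabulate (λ u' → G u u') ∣

degU' : ∀ {n} → BipGraph n → Fin n → ℕ
degU' {n} G u' = ∣ tabulate (λ u → G u u') ∣

edges : ∀ {n} → BipGraph n → ℕ
edges {n} G = sum (map (degU G) (allFin n))

IsMinDegree : ∀ {n} → BipGraph n → ℕ → Set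
IsMinDegree {n} G δ =
  ((u : Fin n) → δ ≤ degU G u) × ((u' : Fin n) → δ ≤ degU' G u') ×
  ((Σ (Fin n) λ u → degU G u ≡ δ) ⊎ (Σ (Fin n) λ u' → degU' G u' ≡ δ))

HasKUU' : ∀ {n} → BipGraph n → ℕ → ℕ → Set
HasKUU' {n} G a b =
  Σ (Fin a → Fin n) λ f → Σ (Fin b → Fin n) λ g →
    Injective _≡_ _≡_ f × Injective _≡_ _≡_ g ×
    ((i : Fin a) (j : Fin b) → G (f i) (g j) ≡ true)

HasK : ∀ {n} → BipGraph n → ℕ → ℕ → Set
HasK {n} G s t = HasKUU' G s t ⊎ HasKUU' (λ u u' → G u' u) s t

addEdge : ∀ {n} → BipGraph n → Fin n → Fin n → BipGraph n
addEdge G u u' x y with x Data.Fin.≟ u | y Data.Fin.≟ u'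
... | Relation.Nullary.yes _ | Relation.Nullary.yes _ = true
... | _ | _ = G x y

Saturated : ∀ {n} → BipGraph n → ℕ → ℕ → Set
Saturated {n} G s t =
  ¬ HasK G s t ×
  ((u u' : Fin n) → G u u' ≡ false → HasK (addEdge G u u') s t)

-- Let v be a vertex of minimum degree δ, say in U. Adding a non-edge vw creates a copy of
-- K_{s,t} through vw; v cannot lie on its s-side (that would give v at least t - 1 neighbours),
-- so w lies on the s-side and v on the t-side. Hence w has t - 1 neighbours u ≠ v, each with
-- at least s - 1 common neighbours with v. Counting, for every u ∈ U, the s - 1 edges it has
-- anyway plus its edges to non-neighbours of v when it shares s - 1 neighbours with v, gives
-- e(G) ≥ (s - 1) n + (t - 1)(n - δ) ≥ (s + t - 2) n - (t - 1)(t - 2), as δ ≤ t - 2.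
-- If v has no non-neighbours then n = δ < t - 1 and e(G) ≥ n² already suffices.
module Submission where

open import Defs
open import Data.Bool using (Bool; true; false; not; _∧_)
open import Data.Bool.Properties using (¬-not; not-injective; T-≡) renaming (_≟_ to _≟ᵇ_)
open import Data.Empty using (⊥-elim)
open import Data.Fin using (Fin; punchIn) renaming (zero to fzero; suc to fsuc)
open import Data.Fin.Properties
  using (any?; injective⇒≤; punchIn-injective; punchInᵢ≢i)
  renaming (_≟_ to _≟ᶠ_; suc-injective to fsuc-injective)
open import Data.Fin.Subset using (Subset; ∣_∣; _∈_)
import Data.List as List using (tabulate)
open import Data.List.Properties using (map-tabulate)
open import Data.Nat using (ℕ; zero; suc; z≤n; s≤s; _≤_; _<_; _+_; _*_; _∸_; _≤ᵇ_)
import Data.Nat.ListAction as List using (sum)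
open import Data.Nat.Properties
open import Algebra.Properties.Semiring.Sum +-*-semiring
  using (sum; sum-syntax; sum-cong-≗; sum-replicate-zero; ∑-distrib-+; ∑-comm; *-distribˡ-sum)
open import Data.Nat.Tactic.RingSolver using (solve-∀)
open import Data.Product using (Σ; ∃; _×_; _,_; proj₁)
open import Data.Sum using (_⊎_; inj₁; inj₂)
open import Data.Vec using (_∷_; tabulate; here; there)
open import Data.Vec.Properties using (lookup∘tabulate; lookup⇒[]=)
open import Function using (_∘_; id)
open import Function.Bundles using (Equivalence)
open import Function.Definitions using (Injective)
open import Relation.Binary.PropositionalEquality
open import Relation.Nullary using (¬_; yes; no)

∑-const : ∀ n c → ∑[ i < n ] c ≡ n * c
∑-const zero    c = refl
∑-const (suc n) c = cong (c +_) (∑-const n c)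

∑-mono-≤ : ∀ {n} {f g : Fin n → ℕ} → (∀ i → f i ≤ g i) → sum f ≤ sum g
∑-mono-≤ {zero}  f≤g = z≤n
∑-mono-≤ {suc n} f≤g = +-mono-≤ (f≤g fzero) (∑-mono-≤ (f≤g ∘ fsuc))

𝟙 : Bool → ℕ
𝟙 true  = 1
𝟙 false = 0

count : ∀ {n} → (Fin n → Bool) → ℕ
count {n} p = ∑[ x < n ] 𝟙 (p x)

∣tabulate∣≡count : ∀ {n} (p : Fin n → Bool) → ∣ tabulate p ∣ ≡ count p
∣tabulate∣≡count {zero}  p = refl
∣tabulate∣≡count {suc n} p with p fzero
... | true  = cong suc (∣tabulate∣≡count (p ∘ fsuc))
... | false = ∣tabulate∣≡count (p ∘ fsuc)

count-complement : ∀ {n} (p : Fin n → Bool) → count p + count (not ∘ p) ≡ n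
count-complement {n} p = begin
  count p + count (not ∘ p)              ≡⟨ ∑-distrib-+ (𝟙 ∘ p) (𝟙 ∘ not ∘ p) ⟨
  ∑[ x < n ] (𝟙 (p x) + 𝟙 (not (p x)))   ≡⟨ sum-cong-≗ (λ x → 𝟙-complement (p x)) ⟩
  ∑[ x < n ] 1                           ≡⟨ ∑-const n 1 ⟩
  n * 1                                  ≡⟨ *-identityʳ n ⟩
  n                                      ∎
  where
  open ≡-Reasoning
  𝟙-complement : ∀ b → 𝟙 b + 𝟙 (not b) ≡ 1
  𝟙-complement true  = refl
  𝟙-complement false = refl

count-split : ∀ {n} (p q : Fin n → Bool) →
  count p ≡ count (λ x → p x ∧ q x) + count (λ x → p x ∧ not (q x))
count-split p q = trans (sum-cong-≗ (λ x → 𝟙-split (p x) (q x)))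
                        (∑-distrib-+ (λ x → 𝟙 (p x ∧ q x)) (λ x → 𝟙 (p x ∧ not (q x))))
  where
  𝟙-split : ∀ b c → 𝟙 b ≡ 𝟙 (b ∧ c) + 𝟙 (b ∧ not c)
  𝟙-split true  true  = refl
  𝟙-split true  false = refl
  𝟙-split false c     = refl

*-𝟙-≤ : ∀ m {k} b → (b ≡ true → m ≤ k) → m * 𝟙 b ≤ k
*-𝟙-≤ m {k} true  m≤k = subst (_≤ k) (sym (*-identityʳ m)) (m≤k refl)
*-𝟙-≤ m {k} false _   = subst (_≤ k) (sym (*-zeroʳ m)) z≤n

rank : ∀ {n} {p : Subset n} {x} → x ∈ p → Fin ∣ p ∣
rank here                        = fzero
rank {p = true  ∷ _} (there x∈p) = fsuc (rank x∈p)
rank {p = false ∷ _} (there x∈p) = rank x∈p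

rank-injective : ∀ {n} {p : Subset n} {x y} (x∈p : x ∈ p) (y∈p : y ∈ p) →
  rank x∈p ≡ rank y∈p → x ≡ y
rank-injective here here _ = refl
rank-injective {p = true  ∷ _} (there x∈p) (there y∈p) eq =
  cong fsuc (rank-injective x∈p y∈p (fsuc-injective eq))
rank-injective {p = false ∷ _} (there x∈p) (there y∈p) eq =
  cong fsuc (rank-injective x∈p y∈p eq)

injection⇒≤∣p∣ : ∀ {k n} {p : Subset n} (f : Fin k → Fin n) → Injective _≡_ _≡_ f →
  (∀ i → f i ∈ p) → k ≤ ∣ p ∣
injection⇒≤∣p∣ f f-injective f∈p =
  injective⇒≤ (λ eq → f-injective (rank-injective (f∈p _) (f∈p _) eq))

injection⇒≤count : ∀ {k n} (p : Fin n → Bool) (f : Fin k → Fin n) →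
  Injective _≡_ _≡_ f → (∀ i → p (f i) ≡ true) → k ≤ count p
injection⇒≤count p f f-injective pf = subst (_ ≤_) (∣tabulate∣≡count p)
  (injection⇒≤∣p∣ f f-injective λ i →
    lookup⇒[]= (f i) (tabulate p) (trans (lookup∘tabulate p (f i)) (pf i)))

∘punchIn-injective : ∀ {k n} (f : Fin (suc k) → Fin n) → Injective _≡_ _≡_ f →
  ∀ i₀ → Injective _≡_ _≡_ (f ∘ punchIn i₀)
∘punchIn-injective f f-injective i₀ eq = punchIn-injective i₀ _ _ (f-injective eq)

∘punchIn-avoids : ∀ {k n} {f : Fin (suc k) → Fin n} {i₀ a} → Injective _≡_ _≡_ f →
  f i₀ ≡ a → ∀ i → f (punchIn i₀ i) ≢ a
∘punchIn-avoids {i₀ = i₀} f-injective fi₀≡a i eq =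
  punchInᵢ≢i i₀ i (f-injective (trans eq (sym fi₀≡a)))

transpose : ∀ {n} → BipGraph n → BipGraph n
transpose G x y = G y x

HasK-transpose : ∀ {n} {G : BipGraph n} {s t} → HasK G s t → HasK (transpose G) s t
HasK-transpose (inj₁ copy) = inj₂ copy
HasK-transpose (inj₂ copy) = inj₁ copy

_⊆_+⟨_,_⟩ : ∀ {n} → BipGraph n → BipGraph n → Fin n → Fin n → Set
G' ⊆ G +⟨ a , b ⟩ = ∀ x y → G' x y ≡ true → G x y ≡ true ⊎ (x ≡ a × y ≡ b)

addEdge-⊆ : ∀ {n} (G : BipGraph n) a b → addEdge G a b ⊆ G +⟨ a , b ⟩
addEdge-⊆ G a b x y xy∈G' with x ≟ᶠ a | y ≟ᶠ b
... | yes x≡a | yes y≡b = inj₂ (x≡a , y≡b)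
... | yes _   | no _    = inj₁ xy∈G'
... | no _    | _       = inj₁ xy∈G'

transpose-⊆ : ∀ {n} {G G' : BipGraph n} {a b} →
  G' ⊆ G +⟨ a , b ⟩ → transpose G' ⊆ transpose G +⟨ b , a ⟩
transpose-⊆ G'⊆G+ab x y yx∈G' with G'⊆G+ab y x yx∈G'
... | inj₁ yx∈G           = inj₁ yx∈G
... | inj₂ (y≡a , x≡b)    = inj₂ (x≡b , y≡a)

⊆-away : ∀ {n} {G G' : BipGraph n} {a b x y} → G' ⊆ G +⟨ a , b ⟩ →
  G' x y ≡ true → x ≢ a ⊎ y ≢ b → G x y ≡ true
⊆-away {x = x} {y} G'⊆G+ab xy∈G' away with G'⊆G+ab x y xy∈G' | away
... | inj₁ xy∈G         | _         = xy∈G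
... | inj₂ (x≡a , _)    | inj₁ x≢a  = ⊥-elim (x≢a x≡a)
... | inj₂ (_ , y≡b)    | inj₂ y≢b  = ⊥-elim (y≢b y≡b)

copy-uses-new-edge : ∀ {n k l} {G G' : BipGraph n} {a b} → G' ⊆ G +⟨ a , b ⟩ →
  ¬ HasKUU' G k l → ((f , g , _) : HasKUU' G' k l) →
  (∃ λ i → f i ≡ a) × (∃ λ j → g j ≡ b)
copy-uses-new-edge {a = a} {b} G'⊆G+ab K-free (f , g , f-inj , g-inj , complete)
  with any? (λ i → f i ≟ᶠ a) | any? (λ j → g j ≟ᶠ b)
... | yes a∈f | yes b∈g = a∈f , b∈g
... | no a∉f  | _       = ⊥-elim (K-free (f , g , f-inj , g-inj ,
      λ i j → ⊆-away G'⊆G+ab (complete i j) (inj₁ (λ fi≡a → a∉f (i , fi≡a)))))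
... | yes _   | no b∉g  = ⊥-elim (K-free (f , g , f-inj , g-inj ,
      λ i j → ⊆-away G'⊆G+ab (complete i j) (inj₂ (λ gj≡b → b∉g (j , gj≡b)))))

new-copy⇒t'≤deg : ∀ {n s' t'} {G G' : BipGraph n} {v w} → G' ⊆ G +⟨ v , w ⟩ →
  ¬ HasKUU' G (suc s') (suc t') → HasKUU' G' (suc s') (suc t') → t' ≤ count (G v)
new-copy⇒t'≤deg {G' = G'} G'⊆G+vw K-free copy@(f , g , _ , g-inj , complete)
  with copy-uses-new-edge G'⊆G+vw K-free copy
... | (i₀ , fi₀≡v) , (j₀ , gj₀≡w) =
  injection⇒≤count _ (g ∘ punchIn j₀) (∘punchIn-injective g g-inj j₀) λ j →
    ⊆-away G'⊆G+vw
      (subst (λ x → G' x (g (punchIn j₀ j)) ≡ true) fi₀≡v (complete i₀ (punchIn j₀ j)))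
      (inj₂ (∘punchIn-avoids g-inj gj₀≡w j))

-- What is left of a copy of K_{s'+1,t'+1} through the new edge vw, with v on the t-side,
-- once v and w are deleted.
record NonEdgeWitness {n} (G : BipGraph n) (s' t' : ℕ) (v w : Fin n) : Set where
  field
    F             : Fin s' → Fin n
    F-injective   : Injective _≡_ _≡_ F
    F-adjacent    : ∀ i → G v (F i) ≡ true
    M             : Fin t' → Fin n
    M-injective   : Injective _≡_ _≡_ M
    M-adjacent    : ∀ j → G (M j) w ≡ true
    MF-adjacent   : ∀ j i → G (M j) (F i) ≡ true

new-copy⇒non-edge-witness : ∀ {n s' t'} {G G' : BipGraph n} {v w} → G' ⊆ G +⟨ v , w ⟩ →
  ¬ HasKUU' (transpose G) (suc s') (suc t') → HasKUU' (transpose G') (suc s') (suc t') →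
  NonEdgeWitness G s' t' v w
new-copy⇒non-edge-witness {G = G} {G'} {v} {w} G'⊆G+vw K-free copy@(f , g , f-inj , g-inj , complete)
  with copy-uses-new-edge (transpose-⊆ G'⊆G+vw) K-free copy
... | (i₀ , fi₀≡w) , (j₀ , gj₀≡v) = record
  { F           = f ∘ punchIn i₀
  ; F-injective = ∘punchIn-injective f f-inj i₀
  ; F-adjacent  = F-adjacent
  ; M           = g ∘ punchIn j₀
  ; M-injective = ∘punchIn-injective g g-inj j₀
  ; M-adjacent  = M-adjacent
  ; MF-adjacent = λ j i → away (complete (punchIn i₀ i) (punchIn j₀ j))
                               (inj₂ (∘punchIn-avoids g-inj gj₀≡v j))
  }
  where
  away : ∀ {x y} → G' y x ≡ true → x ≢ w ⊎ y ≢ v → G y x ≡ true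
  away = ⊆-away (transpose-⊆ G'⊆G+vw)
  F-adjacent : ∀ i → G v (f (punchIn i₀ i)) ≡ true
  F-adjacent i = away (subst (λ y → G' y (f (punchIn i₀ i)) ≡ true) gj₀≡v (complete (punchIn i₀ i) j₀))
                      (inj₁ (∘punchIn-avoids f-inj fi₀≡w i))
  M-adjacent : ∀ j → G (g (punchIn j₀ j)) w ≡ true
  M-adjacent j = away (subst (λ x → G' (g (punchIn j₀ j)) x ≡ true) fi₀≡w (complete i₀ (punchIn j₀ j)))
                      (inj₂ (∘punchIn-avoids g-inj gj₀≡v j))

-- Unlike `Saturated`, this form is stable under transposition.
EdgeSaturated : ∀ {n} → BipGraph n → ℕ → ℕ → Set
EdgeSaturated {n} G s t = ∀ u u' → G u u' ≡ false → ∃ λ G' → G' ⊆ G +⟨ u , u' ⟩ × HasK G' s t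

Saturated⇒EdgeSaturated : ∀ {n} {G : BipGraph n} {s t} → Saturated G s t → EdgeSaturated G s t
Saturated⇒EdgeSaturated {G = G} (_ , saturated) u u' uu'∉G =
  addEdge G u u' , addEdge-⊆ G u u' , saturated u u' uu'∉G

EdgeSaturated-transpose : ∀ {n} {G : BipGraph n} {s t} →
  EdgeSaturated G s t → EdgeSaturated (transpose G) s t
EdgeSaturated-transpose saturated u u' uu'∉Gᵀ with saturated u' u uu'∉Gᵀ
... | G' , G'⊆G+u'u , K = transpose G' , transpose-⊆ G'⊆G+u'u , HasK-transpose {G = G'} K

non-edge-witness : ∀ {n s' t'} (G : BipGraph n) → ¬ HasK G (suc s') (suc t') →
  EdgeSaturated G (suc s') (suc t') → ∀ {v} → count (G v) < t' →
  ∀ w → G v w ≡ false → NonEdgeWitness G s' t' v w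
non-edge-witness G K-free saturated {v} deg<t' w vw∉G with saturated v w vw∉G
... | _ , G'⊆G+vw , inj₁ copy = ⊥-elim (<⇒≱ deg<t' (new-copy⇒t'≤deg G'⊆G+vw (K-free ∘ inj₁) copy))
... | _ , G'⊆G+vw , inj₂ copy = new-copy⇒non-edge-witness G'⊆G+vw (K-free ∘ inj₂) copy

non-neighbours-bound : ∀ {n s' t'} (G : BipGraph n) (v : Fin n) → (∀ u → s' ≤ count (G u)) →
  (∀ w → G v w ≡ false → NonEdgeWitness G s' t' v w) →
  n * s' + t' * count (not ∘ G v) ≤ ∑[ u < n ] count (G u)
non-neighbours-bound {n} {s'} {t'} G v s'≤deg witnessAt = begin
  n * s' + t' * count (not ∘ G v)
    ≡⟨ cong₂ _+_ (sym (∑-const n s')) (*-distribˡ-sum t' (λ x → 𝟙 (not (G v x)))) ⟩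
  ∑[ u < n ] s' + ∑[ x < n ] (t' * 𝟙 (not (G v x)))
    ≤⟨ +-monoʳ-≤ _ (∑-mono-≤ per-non-neighbour) ⟩
  ∑[ u < n ] s' + ∑[ x < n ] ∑[ u < n ] e u x
    ≡⟨ cong (_ +_) (∑-comm e) ⟨
  ∑[ u < n ] s' + ∑[ u < n ] ∑[ x < n ] e u x
    ≡⟨ ∑-distrib-+ (λ _ → s') (λ u → ∑[ x < n ] e u x) ⟨
  ∑[ u < n ] (s' + ∑[ x < n ] e u x)
    ≤⟨ ∑-mono-≤ per-vertex ⟩
  ∑[ u < n ] count (G u)
    ∎
  where
  open ≤-Reasoning
  common : Fin n → ℕ
  common u = count (λ x → G u x ∧ G v x)
  shares : Fin n → Bool
  shares u = s' ≤ᵇ common u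
  e : Fin n → Fin n → ℕ
  e u x = 𝟙 (shares u ∧ (G u x ∧ not (G v x)))
  per-vertex : ∀ u → s' + ∑[ x < n ] 𝟙 (shares u ∧ (G u x ∧ not (G v x))) ≤ count (G u)
  per-vertex u with shares u in shares≡
  ... | true = begin
    s' + count (λ x → G u x ∧ not (G v x))
      ≤⟨ +-monoˡ-≤ _ (≤ᵇ⇒≤ s' (common u) (Equivalence.from T-≡ shares≡)) ⟩
    common u + count (λ x → G u x ∧ not (G v x))  ≡⟨ count-split (G u) (G v) ⟨
    count (G u)                                   ∎
  ... | false = subst (_≤ count (G u))
                  (sym (trans (cong (s' +_) (sum-replicate-zero n)) (+-identityʳ s'))) (s'≤deg u)
  per-non-neighbour : ∀ x → t' * 𝟙 (not (G v x)) ≤ ∑[ u < n ] e u x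
  per-non-neighbour x = *-𝟙-≤ t' (not (G v x)) λ vx∉G →
    let open NonEdgeWitness (witnessAt x (not-injective vx∉G))
        shares-F : ∀ j → s' ≤ common (M j)
        shares-F j = injection⇒≤count _ F F-injective λ i → cong₂ _∧_ (MF-adjacent j i) (F-adjacent i)
    in injection⇒≤count _ M M-injective λ j →
         cong₂ _∧_ (Equivalence.to T-≡ (≤⇒≤ᵇ (shares-F j))) (cong₂ _∧_ (M-adjacent j) vx∉G)

-- (s + t - 2) n - (t - 1)(t - 2) with s' = s - 1 and t' = t - 1.
saturation-bound : ℕ → ℕ → ℕ → ℕ
saturation-bound s' t' n = (s' + t') * n ∸ t' * (t' ∸ 1)

saturation-bound≤n² : ∀ {s' t' n} → s' < t' → n < t' → saturation-bound s' t' n ≤ n * n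
saturation-bound≤n² {s'} {suc a} {n} (s≤s s'≤a) (s≤s n≤a) with m≤n⇒∃[o]m+o≡n n≤a
... | k , refl = m≤n+o⇒m∸n≤o _ (suc (n + k) * (n + k)) (begin
  (s' + suc (n + k)) * n                    ≤⟨ *-monoˡ-≤ n (+-monoˡ-≤ (suc (n + k)) s'≤a) ⟩
  (n + k + suc (n + k)) * n                 ≤⟨ m≤m+n _ (k * k + k) ⟩
  (n + k + suc (n + k)) * n + (k * k + k)   ≡⟨ expand n k ⟩
  suc (n + k) * (n + k) + n * n             ∎)
  where
  open ≤-Reasoning
  expand : ∀ n k → (n + k + suc (n + k)) * n + (k * k + k) ≡ suc (n + k) * (n + k) + n * n
  expand = solve-∀

saturation-bound≤linear : ∀ {s' t' n δ c} → δ + c ≡ n → δ < t' →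
  saturation-bound s' t' n ≤ n * s' + t' * c
saturation-bound≤linear {s'} {suc a} {δ = δ} {c} refl (s≤s δ≤a) = m≤n+o⇒m∸n≤o _ (suc a * a) (begin
  (s' + suc a) * (δ + c)                         ≡⟨ expand s' a δ c ⟩
  suc a * δ + ((δ + c) * s' + suc a * c)         ≤⟨ +-monoˡ-≤ _ (*-monoʳ-≤ (suc a) δ≤a) ⟩
  suc a * a + ((δ + c) * s' + suc a * c)         ∎)
  where
  open ≤-Reasoning
  expand : ∀ s' a δ c → (s' + suc a) * (δ + c) ≡ suc a * δ + ((δ + c) * s' + suc a * c)
  expand = solve-∀

degree-sum-bound : ∀ {n s' t' δ} (G : BipGraph n) (v : Fin n) → s' < t' →
  (∀ u → δ ≤ count (G u)) → count (G v) ≡ δ → δ < t' →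
  (∀ w → G v w ≡ false → NonEdgeWitness G s' t' v w) →
  saturation-bound s' t' n ≤ ∑[ u < n ] count (G u)
degree-sum-bound {n} {s'} {t'} {δ} G v s'<t' δ≤deg degv≡δ δ<t' witnessAt
  with any? (λ w → G v w ≟ᵇ false)
... | yes (w , vw∉G) = begin
  saturation-bound s' t' n
    ≤⟨ saturation-bound≤linear (subst (λ d → d + _ ≡ n) degv≡δ (count-complement (G v))) δ<t' ⟩
  n * s' + t' * count (not ∘ G v)
    ≤⟨ non-neighbours-bound G v (λ u → ≤-trans s'≤δ (δ≤deg u)) witnessAt ⟩
  ∑[ u < n ] count (G u)
    ∎
  where
  open ≤-Reasoning
  open NonEdgeWitness (witnessAt w vw∉G)
  s'≤δ : s' ≤ δ
  s'≤δ = subst (s' ≤_) degv≡δ (injection⇒≤count (G v) F F-injective F-adjacent)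
... | no v-adjacent-to-all = begin
  saturation-bound s' t' n   ≤⟨ saturation-bound≤n² s'<t' (≤-<-trans n≤δ δ<t') ⟩
  n * n                      ≡⟨ ∑-const n n ⟨
  ∑[ u < n ] n               ≤⟨ ∑-mono-≤ (λ u → ≤-trans n≤δ (δ≤deg u)) ⟩
  ∑[ u < n ] count (G u)     ∎
  where
  open ≤-Reasoning
  n≤δ : n ≤ δ
  n≤δ = subst (n ≤_) degv≡δ (injection⇒≤count (G v) id id
          λ w → ¬-not (λ vw∉G → v-adjacent-to-all (w , vw∉G)))

degU≡count : ∀ {n} (G : BipGraph n) u → degU G u ≡ count (G u)
degU≡count G u = ∣tabulate∣≡count (G u)

sum-tabulate : ∀ {n} (f : Fin n → ℕ) → List.sum (List.tabulate f) ≡ sum f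
sum-tabulate {zero}  f = refl
sum-tabulate {suc n} f = cong (f fzero +_) (sum-tabulate (f ∘ fsuc))

edges≡∑count : ∀ {n} (G : BipGraph n) → edges G ≡ ∑[ u < n ] count (G u)
edges≡∑count {n} G = begin
  edges G                              ≡⟨ cong List.sum (map-tabulate id (degU G)) ⟩
  List.sum (List.tabulate (degU G))    ≡⟨ sum-tabulate (degU G) ⟩
  sum (degU G)                         ≡⟨ sum-cong-≗ (degU≡count G) ⟩
  ∑[ u < n ] count (G u)               ∎
  where open ≡-Reasoning

edges≡∑count-transpose : ∀ {n} (G : BipGraph n) → edges G ≡ ∑[ u < n ] count (transpose G u)
edges≡∑count-transpose G = trans (edges≡∑count G) (∑-comm (λ u x → 𝟙 (G u x)))

bound-at-minimum-degree : ∀ {n s' t' δ} (G : BipGraph n) → s' < t' →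
  ¬ HasK G (suc s') (suc t') → EdgeSaturated G (suc s') (suc t') →
  (∀ u → δ ≤ degU G u) → ∀ v → degU G v ≡ δ → δ < t' →
  saturation-bound s' t' n ≤ ∑[ u < n ] count (G u)
bound-at-minimum-degree {t' = t'} {δ} G s'<t' K-free saturated δ≤deg v degv≡δ δ<t' =
  degree-sum-bound G v s'<t' (λ u → subst (_ ≤_) (degU≡count G u) (δ≤deg u)) degv≡δ′ δ<t'
    (non-edge-witness G K-free saturated (subst (_< t') (sym degv≡δ′) δ<t'))
  where
  degv≡δ′ : count (G v) ≡ δ
  degv≡δ′ = trans (sym (degU≡count G v)) degv≡δ

proposition2p1 : (s t n δ : ℕ) → 1 ≤ s → s < t →
    (G : BipGraph n) → Saturated G s t → IsMinDegree G δ → δ < t ∸ 1 →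
    (s + t ∸ 2) * n ∸ (t ∸ 1) * (t ∸ 2) ≤ edges G
proposition2p1 (suc s') (suc t') n δ (s≤s z≤n) (s≤s s'<t') G G-saturated (δ≤degU , δ≤degU' , attained) δ<t' =
  subst (λ m → m * n ∸ t' * (t' ∸ 1) ≤ edges G) (cong (_∸ 1) (sym (+-suc s' t'))) (bound attained)
  where
  K-free : ¬ HasK G (suc s') (suc t')
  K-free = proj₁ G-saturated
  saturated : EdgeSaturated G (suc s') (suc t')
  saturated = Saturated⇒EdgeSaturated G-saturated
  bound : (Σ (Fin n) λ u → degU G u ≡ δ) ⊎ (Σ (Fin n) λ u' → degU' G u' ≡ δ) →
    saturation-bound s' t' n ≤ edges G
  bound (inj₁ (v , degv≡δ)) = subst (_ ≤_) (sym (edges≡∑count G))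
    (bound-at-minimum-degree G s'<t' K-free saturated δ≤degU v degv≡δ δ<t')
  bound (inj₂ (v , degv≡δ)) = subst (_ ≤_) (sym (edges≡∑count-transpose G))
    (bound-at-minimum-degree (transpose G) s'<t' (K-free ∘ HasK-transpose {G = transpose G})
      (EdgeSaturated-transpose saturated) δ≤degU' v degv≡δ δ<t')
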